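{- Let $\mathbb{F}$ be a field, $d\ge0$, and $T\in{\rm Mat}_{d+1}(\mathbb{F})$ invertible upper triangular. Then $T$ is good if and only if $T^{ -1}$ is good.
   Context: Matrices are indexed by $0,\dots,d$; for $0\le i\le j\le d$, $T[i,j]$ is the submatrix with rows $0,\dots,j-i$ and columns $i,\dots,j$. $T$ is good if $T[i,d]$ is invertible for all $0\le i\le d$. -}

module Defs where

open import Level using (Level; _⊔_; suc)
open import Algebra.Bundles using (CommutativeRing)
open import Data.Nat as ℕ using (ℕ; zero; _∸_; _<_; _≤_; s≤s)
open import Data.Nat.Properties using (≤-trans; m∸n≤m; +-monoʳ-≤; m+[n∸m]≡n)
open import Data.Fin as Fin using (Fin; toℕ; fromℕ<)
open import Data.Fin.Properties using (toℕ≤pred[n])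
open import Data.Product using (Σ; _×_; ∃)
open import Relation.Nullary using (¬_)
open import Relation.Binary.PropositionalEquality using (subst)

record Field (c ℓ : Level) : Set (Level.suc (c ⊔ ℓ)) where
  field
    commutativeRing : CommutativeRing c ℓ
  open CommutativeRing commutativeRing public
  field
    1≉0     : ¬ (1# ≈ 0#)
    inverse : ∀ x → ¬ (x ≈ 0#) → Σ Carrier λ y → (x * y) ≈ 1#

module MatrixDefs {c ℓ} (F : Field c ℓ) where
  open Field F

  Matrix : ℕ → Set c
  Matrix n = Fin n → Fin n → Carrier

  ∑ : ∀ {n} → (Fin n → Carrier) → Carrier
  ∑ {zero}  f = 0#
  ∑ {ℕ.suc n} f = f Fin.zero + ∑ (λ k → f (Fin.suc k))

  _⊗_ : ∀ {n} → Matrix n → Matrix n → Matrix n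
  (A ⊗ B) i j = ∑ (λ k → A i k * B k j)

  I : ∀ {n} → Matrix n
  I i j with i Fin.≟ j
  ... | Relation.Nullary.yes _ = 1#
  ... | Relation.Nullary.no  _ = 0#

  _≋_ : ∀ {n} → Matrix n → Matrix n → Set ℓ
  A ≋ B = ∀ i j → A i j ≈ B i j

  IsInverse : ∀ {n} → Matrix n → Matrix n → Set ℓ
  IsInverse A B = ((A ⊗ B) ≋ I) × ((B ⊗ A) ≋ I)

  Invertible : ∀ {n} → Matrix n → Set (c ⊔ ℓ)
  Invertible A = ∃ λ B → IsInverse A B

  UpperTriangular : ∀ {n} → Matrix n → Set ℓ
  UpperTriangular A = ∀ i j → toℕ j < toℕ i → A i j ≈ 0#

  private
    rowBound : ∀ {d} (i : Fin (ℕ.suc d)) (r : Fin (ℕ.suc (d ∸ toℕ i))) →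
               toℕ r < ℕ.suc d
    rowBound {d} i r = s≤s (≤-trans (toℕ≤pred[n] r) (m∸n≤m d (toℕ i)))

    colBound : ∀ {d} (i : Fin (ℕ.suc d)) (r : Fin (ℕ.suc (d ∸ toℕ i))) →
               toℕ i ℕ.+ toℕ r < ℕ.suc d
    colBound {d} i r =
      s≤s (subst (toℕ i ℕ.+ toℕ r ≤_) (m+[n∸m]≡n (toℕ≤pred[n] i))
                 (+-monoʳ-≤ (toℕ i) (toℕ≤pred[n] r)))

  -- For a matrix T indexed by 0,…,d and 0 ≤ i ≤ d, T[i,d] is the
  -- (d-i+1)×(d-i+1) submatrix with rows 0,…,d-i and columns i,…,d:
  -- entry (r, c) is T r (i + c).
  sub : ∀ {d} → Matrix (ℕ.suc d) → (i : Fin (ℕ.suc d)) →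
        Matrix (ℕ.suc (d ∸ toℕ i))
  sub T i r c = T (fromℕ< (rowBound i r)) (fromℕ< (colBound i c))

  Good : ∀ {d} → Matrix (ℕ.suc d) → Set (c ⊔ ℓ)
  Good T = ∀ i → Invertible (sub T i)

module Submission where

-- The corners T[i,d] are top-right square blocks.  The key fact is the
-- complementary-block (Jacobi) lemma: if M N = N M = I are n×n matrices
-- with n = a + b, then the top-right a×a block of M is invertible iff the
-- top-right b×b block of N is.  Writing M = [P Q; R S] (row blocks a, b;
-- column blocks b, a) with Q invertible, the block N₁₂ of N is inverted by
-- the Schur complement R − S Q⁻¹ P; this is a short computation with the
-- block equations of M N = I and N M = I.
--
-- T[0,d] is T itself, which is invertible.

open import Defs
open import Data.Nat as ℕ using (ℕ; zero; suc; _∸_)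
import Data.Nat.Properties as ℕₚ
open import Level using (_⊔_)
open import Data.Fin as Fin using (Fin; toℕ; _↑ˡ_; _↑ʳ_; opposite)
open import Data.Fin.Properties
  using (toℕ-injective; toℕ-fromℕ<; toℕ<n; toℕ≤pred[n]; toℕ-↑ˡ; toℕ-↑ʳ; opposite-prop; suc-injective)
open import Data.Product using (_×_; _,_; proj₁; proj₂)
open import Function using (_∘_)
open import Relation.Nullary using (yes; no; contradiction)
open import Relation.Binary.PropositionalEquality as ≡ using (_≡_; _≢_)
open import Relation.Binary.Bundles using (Setoid)
import Relation.Binary.Reasoning.Setoid as SetoidReasoning

module ComplementaryBlocks {c ℓ} (F : Field c ℓ) where
  open Field F hiding (zero)
  open MatrixDefs F
  open import Algebra.Properties.Ring ring
    using (-0#≈0#; -‿involutive; -‿+-comm; +-inverseˡ-unique; +-inverseʳ-unique; -‿distribˡ-*; -‿distribʳ-*)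
  open import Algebra.Properties.CommutativeSemigroup +-commutativeSemigroup
    using (interchange)

  ∑-cong : ∀ {n} {f g : Fin n → Carrier} → (∀ k → f k ≈ g k) → ∑ f ≈ ∑ g
  ∑-cong {zero}  f≈g = refl
  ∑-cong {suc n} f≈g = +-cong (f≈g Fin.zero) (∑-cong (f≈g ∘ Fin.suc))

  ∑-zero : ∀ n → ∑ {n} (λ _ → 0#) ≈ 0#
  ∑-zero zero    = refl
  ∑-zero (suc n) = trans (+-identityˡ _) (∑-zero n)

  ∑-+ : ∀ {n} (f g : Fin n → Carrier) → ∑ (λ k → f k + g k) ≈ ∑ f + ∑ g
  ∑-+ {zero}  f g = sym (+-identityˡ 0#)
  ∑-+ {suc n} f g =
    trans (+-congˡ (∑-+ (f ∘ Fin.suc) (g ∘ Fin.suc))) (interchange _ _ _ _)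

  ∑-neg : ∀ {n} (f : Fin n → Carrier) → ∑ (λ k → - f k) ≈ - ∑ f
  ∑-neg {zero}  f = sym -0#≈0#
  ∑-neg {suc n} f = trans (+-congˡ (∑-neg (f ∘ Fin.suc))) (-‿+-comm _ _)

  ∑-*ˡ : ∀ {n} x (f : Fin n → Carrier) → x * ∑ f ≈ ∑ (λ k → x * f k)
  ∑-*ˡ {zero}  x f = zeroʳ x
  ∑-*ˡ {suc n} x f = trans (distribˡ x _ _) (+-congˡ (∑-*ˡ x (f ∘ Fin.suc)))

  ∑-*ʳ : ∀ {n} x (f : Fin n → Carrier) → ∑ f * x ≈ ∑ (λ k → f k * x)
  ∑-*ʳ {zero}  x f = zeroˡ x
  ∑-*ʳ {suc n} x f = trans (distribʳ x _ _) (+-congˡ (∑-*ʳ x (f ∘ Fin.suc)))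

  ∑-swap : ∀ {m n} (h : Fin m → Fin n → Carrier) →
           ∑ (λ i → ∑ (h i)) ≈ ∑ (λ j → ∑ (λ i → h i j))
  ∑-swap {zero}  {n} h = sym (∑-zero n)
  ∑-swap {suc m}     h = trans (+-congˡ (∑-swap (h ∘ Fin.suc)))
                               (sym (∑-+ (h Fin.zero) (λ j → ∑ (λ i → h (Fin.suc i) j))))

  ∑-++ : ∀ p {q} (h : Fin (p ℕ.+ q) → Carrier) →
         ∑ h ≈ ∑ (h ∘ (_↑ˡ q)) + ∑ (h ∘ (p ↑ʳ_))
  ∑-++ zero    h = sym (+-identityˡ _)
  ∑-++ (suc p) h = trans (+-congˡ (∑-++ p (h ∘ Fin.suc))) (sym (+-assoc _ _ _))

  I-reindex : ∀ {m n} {i j : Fin m} {i′ j′ : Fin n} →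
              (i ≡ j → i′ ≡ j′) → (i′ ≡ j′ → i ≡ j) → I i j ≈ I i′ j′
  I-reindex {i = i} {j} {i′} {j′} to from with i Fin.≟ j | i′ Fin.≟ j′
  ... | yes _   | yes _    = refl
  ... | yes i≡j | no i′≢j′ = contradiction (to i≡j) i′≢j′
  ... | no i≢j  | yes i′≡j′ = contradiction (from i′≡j′) i≢j
  ... | no _    | no _     = refl

  I-off : ∀ {n} {i j : Fin n} → i ≢ j → I i j ≈ 0#
  I-off {i = i} {j} i≢j with i Fin.≟ j
  ... | yes i≡j = contradiction i≡j i≢j
  ... | no _    = refl

  I-suc : ∀ {n} (i j : Fin n) → I (Fin.suc i) (Fin.suc j) ≈ I i j
  I-suc i j = I-reindex {i = Fin.suc i} {Fin.suc j} {i} {j} suc-injective (≡.cong Fin.suc)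

  ∑-δ : ∀ {n} (i : Fin n) (f : Fin n → Carrier) → ∑ (λ k → I i k * f k) ≈ f i
  ∑-δ {suc n} Fin.zero f = begin
    1# * f Fin.zero + ∑ (λ k → 0# * f (Fin.suc k))  ≈⟨ +-cong (*-identityˡ _) (∑-cong {n} (λ k → zeroˡ (f (Fin.suc k)))) ⟩
    f Fin.zero + ∑ {n} (λ _ → 0#)                   ≈⟨ +-congˡ (∑-zero n) ⟩
    f Fin.zero + 0#                                 ≈⟨ +-identityʳ _ ⟩
    f Fin.zero                                      ∎
    where open SetoidReasoning setoid
  ∑-δ {suc n} (Fin.suc i) f = begin
    0# * f Fin.zero + ∑ (λ k → I (Fin.suc i) (Fin.suc k) * f (Fin.suc k))
      ≈⟨ +-cong (zeroˡ _) (∑-cong (λ k → *-congʳ (I-suc i k))) ⟩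
    0# + ∑ (λ k → I i k * f (Fin.suc k))
      ≈⟨ +-identityˡ _ ⟩
    ∑ (λ k → I i k * f (Fin.suc k))
      ≈⟨ ∑-δ i (f ∘ Fin.suc) ⟩
    f (Fin.suc i)
      ∎
    where open SetoidReasoning setoid

  -- Rectangular matrices.  For m = n these are the matrices of Defs, and
  -- _·_ and _≈ₘ_ unfold to _⊗_ and _≋_.

  Mat : ℕ → ℕ → Set c
  Mat m n = Fin m → Fin n → Carrier

  infixl 7 _·_
  infixl 6 _⊕_
  infix  4 _≈ₘ_

  _·_ : ∀ {m k n} → Mat m k → Mat k n → Mat m n
  (A · B) i j = ∑ (λ t → A i t * B t j)

  _⊕_ : ∀ {m n} → Mat m n → Mat m n → Mat m n
  (A ⊕ B) i j = A i j + B i j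

  ⊝_ : ∀ {m n} → Mat m n → Mat m n
  (⊝ A) i j = - A i j

  𝟘 : ∀ {m n} → Mat m n
  𝟘 _ _ = 0#

  _≈ₘ_ : ∀ {m n} → Mat m n → Mat m n → Set ℓ
  A ≈ₘ B = ∀ i j → A i j ≈ B i j

  Mat-setoid : ℕ → ℕ → Setoid c ℓ
  Mat-setoid m n = record
    { Carrier       = Mat m n
    ; _≈_           = _≈ₘ_
    ; isEquivalence = record
      { refl  = λ i j → refl
      ; sym   = λ A≈B i j → sym (A≈B i j)
      ; trans = λ A≈B B≈C i j → trans (A≈B i j) (B≈C i j)
      }
    }

  block : ∀ {m n m′ n′} → Mat m n → (Fin m′ → Fin m) → (Fin n′ → Fin n) → Mat m′ n′
  block M r s x y = M (r x) (s y)

  ·-congˡ : ∀ {m k n} (A : Mat m k) {B B′ : Mat k n} → B ≈ₘ B′ → A · B ≈ₘ A · B′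
  ·-congˡ A B≈B′ i j = ∑-cong (λ t → *-congˡ (B≈B′ t j))

  ·-congʳ : ∀ {m k n} {A A′ : Mat m k} (B : Mat k n) → A ≈ₘ A′ → A · B ≈ₘ A′ · B
  ·-congʳ B A≈A′ i j = ∑-cong (λ t → *-congʳ (A≈A′ i t))

  ⊕-congˡ : ∀ {m n} (A : Mat m n) {B B′ : Mat m n} → B ≈ₘ B′ → A ⊕ B ≈ₘ A ⊕ B′
  ⊕-congˡ A B≈B′ i j = +-congˡ (B≈B′ i j)

  ⊝-cong : ∀ {m n} {A A′ : Mat m n} → A ≈ₘ A′ → ⊝ A ≈ₘ ⊝ A′
  ⊝-cong A≈A′ i j = -‿cong (A≈A′ i j)

  ·-assoc : ∀ {m k l n} (A : Mat m k) (B : Mat k l) (C : Mat l n) →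
            (A · B) · C ≈ₘ A · (B · C)
  ·-assoc A B C i j = begin
    ∑ (λ t → ∑ (λ s → A i s * B s t) * C t j)    ≈⟨ ∑-cong (λ t → ∑-*ʳ (C t j) (λ s → A i s * B s t)) ⟩
    ∑ (λ t → ∑ (λ s → (A i s * B s t) * C t j))  ≈⟨ ∑-swap (λ t s → (A i s * B s t) * C t j) ⟩
    ∑ (λ s → ∑ (λ t → (A i s * B s t) * C t j))  ≈⟨ ∑-cong (λ s → ∑-cong (λ t → *-assoc (A i s) (B s t) (C t j))) ⟩
    ∑ (λ s → ∑ (λ t → A i s * (B s t * C t j)))  ≈⟨ ∑-cong (λ s → ∑-*ˡ (A i s) (λ t → B s t * C t j)) ⟨
    ∑ (λ s → A i s * ∑ (λ t → B s t * C t j))    ∎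
    where open SetoidReasoning setoid

  ·-identityˡ : ∀ {m n} (A : Mat m n) → I · A ≈ₘ A
  ·-identityˡ A i j = ∑-δ i (λ k → A k j)

  ·-distribˡ-⊕ : ∀ {m k n} (A : Mat m k) (B C : Mat k n) → A · (B ⊕ C) ≈ₘ A · B ⊕ A · C
  ·-distribˡ-⊕ A B C i j =
    trans (∑-cong (λ t → distribˡ (A i t) _ _)) (∑-+ (λ t → A i t * B t j) (λ t → A i t * C t j))

  ·-distribʳ-⊕ : ∀ {m k n} (B C : Mat m k) (A : Mat k n) → (B ⊕ C) · A ≈ₘ B · A ⊕ C · A
  ·-distribʳ-⊕ B C A i j =
    trans (∑-cong (λ t → distribʳ (A t j) _ _)) (∑-+ (λ t → B i t * A t j) (λ t → C i t * A t j))

  ·-negˡ : ∀ {m k n} (A : Mat m k) (B : Mat k n) → (⊝ A) · B ≈ₘ ⊝ (A · B)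
  ·-negˡ A B i j = trans (∑-cong (λ t → sym (-‿distribˡ-* (A i t) (B t j)))) (∑-neg (λ t → A i t * B t j))

  ·-negʳ : ∀ {m k n} (A : Mat m k) (B : Mat k n) → A · (⊝ B) ≈ₘ ⊝ (A · B)
  ·-negʳ A B i j = trans (∑-cong (λ t → sym (-‿distribʳ-* (A i t) (B t j)))) (∑-neg (λ t → A i t * B t j))

  ·-inverse-cancel : ∀ {a n} {Q X : Mat a a} → Q · X ≈ₘ I → (P : Mat a n) → Q · (X · P) ≈ₘ P
  ·-inverse-cancel {Q = Q} {X} QX≈I P i j = begin
    (Q · (X · P)) i j  ≈⟨ ·-assoc Q X P i j ⟨
    ((Q · X) · P) i j  ≈⟨ ·-congʳ P QX≈I i j ⟩
    (I · P) i j        ≈⟨ ·-identityˡ P i j ⟩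
    P i j              ∎
    where open SetoidReasoning setoid

  ⊝-uniqueˡ : ∀ {m n} {A B : Mat m n} → A ⊕ B ≈ₘ 𝟘 → A ≈ₘ ⊝ B
  ⊝-uniqueˡ A⊕B≈𝟘 i j = +-inverseˡ-unique _ _ (A⊕B≈𝟘 i j)

  ⊝-uniqueʳ : ∀ {m n} {A B : Mat m n} → A ⊕ B ≈ₘ 𝟘 → B ≈ₘ ⊝ A
  ⊝-uniqueʳ A⊕B≈𝟘 i j = +-inverseʳ-unique _ _ (A⊕B≈𝟘 i j)

  ⊕-⊝-cancel : ∀ {m n} {U V W J : Mat m n} → W ≈ₘ ⊝ V → U ⊕ V ≈ₘ J → U ⊕ ⊝ W ≈ₘ J
  ⊕-⊝-cancel W≈⊝V U⊕V≈J i j =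
    trans (+-congˡ (trans (-‿cong (W≈⊝V i j)) (-‿involutive _))) (U⊕V≈J i j)

  IsInverse-respˡ : ∀ {n} {A A′ X : Matrix n} → A ≋ A′ → IsInverse A X → IsInverse A′ X
  IsInverse-respˡ {A = A} {A′} {X} A≈A′ (AX≈I , XA≈I) =
    (λ i j → trans (·-congʳ X (λ i′ j′ → sym (A≈A′ i′ j′)) i j) (AX≈I i j)) ,
    (λ i j → trans (·-congˡ X (λ i′ j′ → sym (A≈A′ i′ j′)) i j) (XA≈I i j))

  Invertible-resp : ∀ {n} {A A′ : Matrix n} → A ≋ A′ → Invertible A → Invertible A′
  Invertible-resp A≈A′ (X , A⁻¹) = X , IsInverse-respˡ A≈A′ A⁻¹

  -- Let M = [P Q; R S] have row blocks of sizes a, b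
  -- and column blocks of sizes b, a, with Q invertible with inverse X.
  -- Whenever N₁₂ (b×b) satisfies the block equations of N M = I, resp.
  -- M N = I, involving it, the matrix R − S X P is its right, resp. left,
  -- inverse.
  module SchurComplement {a b} (P : Mat a b) (Q : Mat a a) (R : Mat b b) (S : Mat b a)
                         {X : Mat a a} (Q⁻¹ : IsInverse Q X) where

    schur : Mat b b
    schur = R ⊕ ⊝ (S · (X · P))

    schur-rightInverse : (N₁₁ : Mat b a) (N₁₂ : Mat b b) →
      N₁₁ · P ⊕ N₁₂ · R ≈ₘ I → N₁₁ · Q ⊕ N₁₂ · S ≈ₘ 𝟘 → N₁₂ · schur ≈ₘ I
    schur-rightInverse N₁₁ N₁₂ E₁ E₂ = begin
      N₁₂ · schur                          ≈⟨ ·-distribˡ-⊕ N₁₂ R _ ⟩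
      N₁₂ · R ⊕ N₁₂ · (⊝ (S · (X · P)))    ≈⟨ ⊕-congˡ (N₁₂ · R) (·-negʳ N₁₂ _) ⟩
      N₁₂ · R ⊕ ⊝ (N₁₂ · (S · (X · P)))    ≈⟨ ⊕-⊝-cancel N₁₂SXP≈-N₁₁P (λ i j → trans (+-comm _ _) (E₁ i j)) ⟩
      I                                    ∎
      where
      open SetoidReasoning (Mat-setoid b b)
      N₁₂SXP≈-N₁₁P : N₁₂ · (S · (X · P)) ≈ₘ ⊝ (N₁₁ · P)
      N₁₂SXP≈-N₁₁P = begin
        N₁₂ · (S · (X · P))        ≈⟨ ·-assoc N₁₂ S _ ⟨
        (N₁₂ · S) · (X · P)        ≈⟨ ·-congʳ (X · P) (⊝-uniqueʳ E₂) ⟩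
        (⊝ (N₁₁ · Q)) · (X · P)    ≈⟨ ·-negˡ (N₁₁ · Q) _ ⟩
        ⊝ ((N₁₁ · Q) · (X · P))    ≈⟨ ⊝-cong (·-assoc N₁₁ Q _) ⟩
        ⊝ (N₁₁ · (Q · (X · P)))    ≈⟨ ⊝-cong (·-congˡ N₁₁ (·-inverse-cancel (proj₁ Q⁻¹) P)) ⟩
        ⊝ (N₁₁ · P)                ∎

    schur-leftInverse : (N₁₂ : Mat b b) (N₂₂ : Mat a b) →
      R · N₁₂ ⊕ S · N₂₂ ≈ₘ I → P · N₁₂ ⊕ Q · N₂₂ ≈ₘ 𝟘 → schur · N₁₂ ≈ₘ I
    schur-leftInverse N₁₂ N₂₂ E₃ E₄ = begin
      schur · N₁₂                          ≈⟨ ·-distribʳ-⊕ R _ N₁₂ ⟩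
      R · N₁₂ ⊕ (⊝ (S · (X · P))) · N₁₂    ≈⟨ ⊕-congˡ (R · N₁₂) (·-negˡ _ N₁₂) ⟩
      R · N₁₂ ⊕ ⊝ ((S · (X · P)) · N₁₂)    ≈⟨ ⊕-⊝-cancel SXPN₁₂≈-SN₂₂ E₃ ⟩
      I                                    ∎
      where
      open SetoidReasoning (Mat-setoid b b)
      SXPN₁₂≈-SN₂₂ : (S · (X · P)) · N₁₂ ≈ₘ ⊝ (S · N₂₂)
      SXPN₁₂≈-SN₂₂ = begin
        (S · (X · P)) · N₁₂        ≈⟨ ·-assoc S _ N₁₂ ⟩
        S · ((X · P) · N₁₂)        ≈⟨ ·-congˡ S (·-assoc X P N₁₂) ⟩
        S · (X · (P · N₁₂))        ≈⟨ ·-congˡ S (·-congˡ X (⊝-uniqueˡ E₄)) ⟩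
        S · (X · (⊝ (Q · N₂₂)))    ≈⟨ ·-congˡ S (·-negʳ X _) ⟩
        S · (⊝ (X · (Q · N₂₂)))    ≈⟨ ·-negʳ S _ ⟩
        ⊝ (S · (X · (Q · N₂₂)))    ≈⟨ ⊝-cong (·-congˡ S (·-inverse-cancel (proj₂ Q⁻¹) N₂₂)) ⟩
        ⊝ (S · N₂₂)                ∎

  record Split (n p q : ℕ) : Set (c ⊔ ℓ) where
    field
      init     : Fin p → Fin n
      last     : Fin q → Fin n
      toℕ-init : ∀ x → toℕ (init x) ≡ toℕ x
      toℕ-last : ∀ y → toℕ (last y) ≡ p ℕ.+ toℕ y
      ∑-split  : (h : Fin n → Carrier) → ∑ h ≈ ∑ (h ∘ init) + ∑ (h ∘ last)

  split : ∀ {n p q} → p ℕ.+ q ≡ n → Split n p q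
  split {p = p} {q} ≡.refl = record
    { init     = _↑ˡ q
    ; last     = p ↑ʳ_
    ; toℕ-init = λ x → toℕ-↑ˡ x q
    ; toℕ-last = toℕ-↑ʳ p
    ; ∑-split  = ∑-++ p
    }

  module _ {n p q} (σ : Split n p q) where
    open Split σ

    I-init : block I init init ≈ₘ I
    I-init x y = I-reindex from (≡.cong init)
      where
      from : init x ≡ init y → x ≡ y
      from e = toℕ-injective (≡.trans (≡.sym (toℕ-init x)) (≡.trans (≡.cong toℕ e) (toℕ-init y)))

    I-last : block I last last ≈ₘ I
    I-last x y = I-reindex from (≡.cong last)
      where
      from : last x ≡ last y → x ≡ y
      from e = toℕ-injective (ℕₚ.+-cancelˡ-≡ p _ _
        (≡.trans (≡.sym (toℕ-last x)) (≡.trans (≡.cong toℕ e) (toℕ-last y))))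

    I-init-last : block I init last ≈ₘ 𝟘
    I-init-last x y = I-off init≢last
      where
      init≢last : init x ≢ last y
      init≢last e = ℕₚ.<-irrefl ≡.refl (ℕₚ.<-≤-trans (toℕ<n x)
        (≡.subst (p ℕ.≤_) (≡.trans (≡.sym (toℕ-last y)) (≡.trans (≡.cong toℕ (≡.sym e)) (toℕ-init x)))
                 (ℕₚ.m≤m+n p (toℕ y))))

  inverse-block : ∀ {n p q m m′} (σ : Split n p q) {A B : Matrix n} → (A ⊗ B) ≋ I →
    (r : Fin m → Fin n) (s : Fin m′ → Fin n) →
    block A r (Split.init σ) · block B (Split.init σ) s ⊕
    block A r (Split.last σ) · block B (Split.last σ) s ≈ₘ block I r s
  inverse-block σ {A} {B} AB≈I r s x y =
    trans (sym (Split.∑-split σ (λ t → A (r x) t * B t (s y)))) (AB≈I (r x) (s y))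

  -- B is the k×k block of M with rows 0,…,k-1 and columns o,…,o+k-1.
  BlockAt : ∀ {k n} → ℕ → Matrix n → Matrix k → Set ℓ
  BlockAt o M B = ∀ r c i j → toℕ i ≡ toℕ r → toℕ j ≡ o ℕ.+ toℕ c → B r c ≈ M i j

  complementary-block : ∀ {n a b} → a ℕ.+ b ≡ n → {M N : Matrix n} → IsInverse M N →
    {A : Matrix a} {B : Matrix b} → BlockAt b M A → BlockAt a N B →
    Invertible A → Invertible B
  complementary-block {n} {a} {b} a+b≡n {M} {N} (MN≈I , NM≈I) {A} {B} A⊑M B⊑N (X , A⁻¹) =
    Invertible-resp N₁₂≈B (schur , schur-rightInverse N₁₁ N₁₂ E₁ E₂ , schur-leftInverse N₁₂ N₂₂ E₃ E₄)
    where
    α : Split n a b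
    α = split a+b≡n
    β : Split n b a
    β = split (≡.trans (ℕₚ.+-comm b a) a+b≡n)
    open Split α renaming (init to α₁; last to α₂; toℕ-init to toℕ-α₁; toℕ-last to toℕ-α₂)
    open Split β renaming (init to β₁; last to β₂; toℕ-init to toℕ-β₁; toℕ-last to toℕ-β₂)

    -- M = [P Q; R S] and N = [N₁₁ N₁₂; N₂₁ N₂₂]; A is Q and B is N₁₂.
    P : Mat a b
    P = block M α₁ β₁
    Q : Mat a a
    Q = block M α₁ β₂
    R : Mat b b
    R = block M α₂ β₁
    S : Mat b a
    S = block M α₂ β₂
    N₁₁ : Mat b a
    N₁₁ = block N β₁ α₁
    N₁₂ : Mat b b
    N₁₂ = block N β₁ α₂
    N₂₂ : Mat a b
    N₂₂ = block N β₂ α₂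

    A≈Q : A ≋ Q
    A≈Q r c = A⊑M r c (α₁ r) (β₂ c) (toℕ-α₁ r) (toℕ-β₂ c)

    N₁₂≈B : N₁₂ ≋ B
    N₁₂≈B r c = sym (B⊑N r c (β₁ r) (α₂ c) (toℕ-β₁ r) (toℕ-α₂ c))

    open SchurComplement P Q R S (IsInverse-respˡ A≈Q A⁻¹)

    E₁ : N₁₁ · P ⊕ N₁₂ · R ≈ₘ I
    E₁ x y = trans (inverse-block α NM≈I β₁ β₁ x y) (I-init β x y)
    E₂ : N₁₁ · Q ⊕ N₁₂ · S ≈ₘ 𝟘
    E₂ x y = trans (inverse-block α NM≈I β₁ β₂ x y) (I-init-last β x y)
    E₃ : R · N₁₂ ⊕ S · N₂₂ ≈ₘ I
    E₃ x y = trans (inverse-block β MN≈I α₂ α₂ x y) (I-last α x y)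
    E₄ : P · N₁₂ ⊕ Q · N₂₂ ≈ₘ 𝟘
    E₄ x y = trans (inverse-block β MN≈I α₁ α₂ x y) (I-init-last α x y)

  sub-block : ∀ {d} (T : Matrix (suc d)) (i : Fin (suc d)) → BlockAt (toℕ i) T (sub T i)
  sub-block T i r c u v u≡r v≡i+c = reflexive (≡.cong₂ T
    (toℕ-injective (≡.trans (toℕ-fromℕ< _) (≡.sym u≡r)))
    (toℕ-injective (≡.trans (toℕ-fromℕ< _) (≡.sym v≡i+c))))

  sub-size : ∀ {d} (i : Fin (suc d)) → suc (d ∸ toℕ i) ℕ.+ toℕ i ≡ suc d
  sub-size i = ≡.cong suc (ℕₚ.m∸n+n≡m (toℕ≤pred[n] i))

  complementary-corners : ∀ {d} {M N : Matrix (suc d)} (i j : Fin (suc d)) →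
    toℕ i ℕ.+ toℕ j ≡ suc d → IsInverse M N →
    Invertible (sub M j) → Invertible (sub N i)
  complementary-corners {d} {M} {N} i j i+j≡n inv =
    complementary-block sizes-complementary inv
      (≡.subst (λ o → BlockAt o M (sub M j)) (≡.sym b≡j) (sub-block M j))
      (≡.subst (λ o → BlockAt o N (sub N i)) (≡.sym a≡i) (sub-block N i))
    where
    a≡i : suc (d ∸ toℕ j) ≡ toℕ i
    a≡i = ℕₚ.+-cancelʳ-≡ (toℕ j) _ _ (≡.trans (sub-size j) (≡.sym i+j≡n))
    b≡j : suc (d ∸ toℕ i) ≡ toℕ j
    b≡j = ℕₚ.+-cancelˡ-≡ (toℕ i) _ _
      (≡.trans (ℕₚ.+-comm (toℕ i) _) (≡.trans (sub-size i) (≡.sym i+j≡n)))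
    sizes-complementary : suc (d ∸ toℕ j) ℕ.+ suc (d ∸ toℕ i) ≡ suc d
    sizes-complementary = ≡.trans (≡.cong₂ ℕ._+_ a≡i b≡j) i+j≡n

  opposite-complement : ∀ {d} (i : Fin d) →
    toℕ (Fin.suc i) ℕ.+ toℕ (Fin.suc (opposite i)) ≡ suc d
  opposite-complement {d} i = begin
    suc m ℕ.+ suc (toℕ (opposite i))  ≡⟨ ≡.cong (λ k → suc m ℕ.+ suc k) (opposite-prop i) ⟩
    suc m ℕ.+ suc (d ∸ suc m)          ≡⟨ ℕₚ.+-suc (suc m) _ ⟩
    suc (suc m ℕ.+ (d ∸ suc m))        ≡⟨ ≡.cong suc (ℕₚ.m+[n∸m]≡n (toℕ<n i)) ⟩
    suc d                              ∎
    where
    m = toℕ i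
    open ≡.≡-Reasoning

  -- Goodness transfers to the inverse: N[0,d] is N itself, and every other
  -- corner N[1+i,d] is complementary to M[1+(d−1−i),d].
  good-transfer : ∀ {d} (M N : Matrix (suc d)) → IsInverse M N → Good M → Good N
  good-transfer M N (MN≈I , NM≈I) _ Fin.zero =
    Invertible-resp (λ r c → sym (sub-block N Fin.zero r c r c ≡.refl ≡.refl)) (M , NM≈I , MN≈I)
  good-transfer {suc d} M N inv good (Fin.suc i) =
    complementary-corners {M = M} {N} (Fin.suc i) (Fin.suc (opposite i)) (opposite-complement i) inv
      (good (Fin.suc (opposite i)))

corollary4p11 : ∀ {c ℓ} (F : Field c ℓ) → let open MatrixDefs F in
    (d : ℕ) (T Tinv : Matrix (suc d)) →
    UpperTriangular T → IsInverse T Tinv →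
    (Good T → Good Tinv) × (Good Tinv → Good T)
corollary4p11 F d T Tinv _ (TTinv≈I , TinvT≈I) =
  good-transfer T Tinv (TTinv≈I , TinvT≈I) , good-transfer Tinv T (TinvT≈I , TTinv≈I)
  where open ComplementaryBlocks F
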